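{- Let $a$ and $m$ be positive integers and $f_0(n)=\binom{n+a-2}{a-1}$ for $n=1,2,\ldots$. For $1\le k\le n$, $c_m(n,k)$ equals the number of words of length $n-1$ over the alphabet $\{0,1,\ldots,a+m-1\}$ that have exactly $k-1$ letters equal to $a+m-1$ and satisfy property $\mathcal P_2$.
   Context: For an arithmetic function $f_0$ defined on the positive integers, define recursively for $m\ge 1$: $c_m(n,k)=\sum_{i_1+\cdots+i_k=n} f_{m-1}(i_1)\cdots f_{m-1}(i_k)$, the sum over all $k$-tuples of positive integers with sum $n$, and $f_m(n)=\sum_{k=1}^n c_m(n,k)$. A word satisfies property $\mathcal P_2$ if every maximal factor (block of consecutive letters) consisting only of letters from $\{0,1,\ldots,a-1\}$ has no rises, i.e. no two consecutive letters $x,y$ in the block with $x<y$. -}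

module Defs where

open import Data.Nat using (ℕ; zero; suc; _+_; _*_; _∸_; _<ᵇ_; _≡ᵇ_)
open import Data.Nat.Combinatorics using (_C_)
open import Data.Bool using (Bool; true; false; _∧_; not; if_then_else_)
open import Data.Nat.ListAction using (sum; product)
open import Data.List using (List; []; _∷_; map; concatMap; length; filterᵇ; upTo)
open import Data.Fin using (Fin; toℕ)
open import Data.Fin using () renaming (zero to fzero)
open import Data.List using (allFin) public

compositions : ℕ → ℕ → List (List ℕ)
compositions zero    zero    = [] ∷ []
compositions (suc n) zero    = []
compositions n       (suc k) =
  concatMap (λ i → map (suc i ∷_) (compositions (n ∸ suc i) k)) (upTo n)

cStep : (ℕ → ℕ) → ℕ → ℕ → ℕ
cStep f n k = sum (map (λ t → product (map f t)) (compositions n k))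

fStep : (ℕ → ℕ) → ℕ → ℕ
fStep f n = sum (map (λ j → cStep f n (suc j)) (upTo n))

fIter : (ℕ → ℕ) → ℕ → (ℕ → ℕ)
fIter f0 zero    = f0
fIter f0 (suc m) = fStep (fIter f0 m)

-- c_m(n,k) for m ≥ 1 (uses f_{m-1})
cm : (ℕ → ℕ) → ℕ → ℕ → ℕ → ℕ
cm f0 m n k = cStep (fIter f0 (m ∸ 1)) n k

f0 : ℕ → ℕ → ℕ
f0 a n = (n + a ∸ 2) C (a ∸ 1)

words : (q len : ℕ) → List (List (Fin q))
words q zero      = [] ∷ []
words q (suc len) = concatMap (λ x → map (x ∷_) (words q len)) (allFin q)

-- Property P₂: every maximal factor consisting only of letters < a has no
-- rise.  Two consecutive letters both < a lie in the same maximal such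
-- factor, and conversely, so this is: no adjacent pair x,y with x < a,
-- y < a and x < y.
P₂ : ∀ {q} → ℕ → List (Fin q) → Bool
P₂ a []           = true
P₂ a (x ∷ [])     = true
P₂ a (x ∷ y ∷ w)  =
  not ((toℕ x <ᵇ a) ∧ (toℕ y <ᵇ a) ∧ (toℕ x <ᵇ toℕ y)) ∧ P₂ a (y ∷ w)

occ : ∀ {q} → ℕ → List (Fin q) → ℕ
occ v []      = 0
occ v (x ∷ w) = (if toℕ x ≡ᵇ v then 1 else 0) + occ v w

wordCount : (a m n k : ℕ) → ℕ
wordCount a m n k =
  length (filterᵇ (λ w → P₂ a w ∧ (occ (a + m ∸ 1) w ≡ᵇ (k ∸ 1)))
                  (words (a + m) (n ∸ 1)))

-- Words are counted by a transfer recursion on the value of the preceding letter.  Letters of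
-- value ≥ a take part in no rise condition, so the occurrences of the largest letter b ≥ a cut a
-- P₂ word over {0,…,b} into independent P₂ words over {0,…,b-1}: this is the composition sum
-- defining c.  Summing over the number of top letters, f_m(n) counts all P₂ words of length n-1
-- over {0,…,a+m-1}, by induction on m; for m = 0 these are the non-increasing words over
-- {0,…,a-1}, counted by the hockey-stick identity.

module Submission where

open import Defs
open import Data.Nat using (ℕ; _≤_)
open import Relation.Binary.PropositionalEquality using (_≡_)

open import Data.Bool using (Bool; true; false; _∧_; not; if_then_else_)
open import Data.Bool.Properties using (∧-zeroʳ)
open import Data.Fin using (Fin; zero; suc; toℕ; fromℕ; inject₁)
open import Data.Fin.Properties using (toℕ<n; toℕ-inject₁; toℕ-fromℕ)
open import Data.List
  using (List; []; _∷_; _++_; map; concatMap; length; filterᵇ; applyUpTo; upTo; tabulate)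
open import Data.List.Properties using (length-++; filter-++; map-++; map-∘)
open import Data.Nat using (zero; suc; _+_; _*_; _∸_; _<_; _<ᵇ_; _≡ᵇ_; _<?_; _≟_; s≤s)
open import Data.Nat.Combinatorics using (_C_; nCn≡1; nCk+nC[k+1]≡[n+1]C[k+1])
open import Data.Nat.ListAction using (sum; product)
open import Data.Nat.ListAction.Properties using (sum-++)
open import Data.Nat.Properties
open import Algebra.Properties.Semiring.Sum +-*-semiring
  using (sum-syntax; sum-cong-≗; sum-init-last; sum-replicate-zero;
         ∑-comm; *-distribˡ-sum; *-distribʳ-sum)
open import Data.Sum using (inj₁; inj₂)
open import Function using (_∘_)
open import Relation.Binary.PropositionalEquality
  using (refl; sym; trans; cong; cong₂; module ≡-Reasoning)
open import Relation.Nullary using (¬_)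
open import Relation.Nullary.Decidable using (dec-true; dec-false)
open import Relation.Nullary.Decidable.Core using (T?)
open ≡-Reasoning

∑< : ℕ → (ℕ → ℕ) → ℕ
∑< n f = ∑[ i < n ] f (toℕ i)

∑<-cong : ∀ n {f g : ℕ → ℕ} → (∀ i → i < n → f i ≡ g i) → ∑< n f ≡ ∑< n g
∑<-cong n e = sum-cong-≗ {n} (λ i → e (toℕ i) (toℕ<n i))

∑<-zero : ∀ n {f : ℕ → ℕ} → (∀ i → i < n → f i ≡ 0) → ∑< n f ≡ 0
∑<-zero n e = trans (∑<-cong n e) (sum-replicate-zero n)

∑<-suc : ∀ n (f : ℕ → ℕ) → ∑< (suc n) f ≡ ∑< n f + f n
∑<-suc n f = begin
  ∑< (suc n) f
    ≡⟨ sum-init-last {n} (λ i → f (toℕ i)) ⟩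
  ∑[ i < n ] f (toℕ (inject₁ i)) + f (toℕ (fromℕ n))
    ≡⟨ cong₂ _+_ (sum-cong-≗ {n} (cong f ∘ toℕ-inject₁)) (cong f (toℕ-fromℕ n)) ⟩
  ∑< n f + f n ∎

∑<-comm : ∀ m n (f : ℕ → ℕ → ℕ) →
  ∑< m (λ i → ∑< n (f i)) ≡ ∑< n (λ j → ∑< m (λ i → f i j))
∑<-comm m n f = ∑-comm {m} {n} (λ i j → f (toℕ i) (toℕ j))

*-distribˡ-∑< : ∀ n c (f : ℕ → ℕ) → c * ∑< n f ≡ ∑< n (λ i → c * f i)
*-distribˡ-∑< n c f = *-distribˡ-sum {n} c (λ i → f (toℕ i))

*-distribʳ-∑< : ∀ n c (f : ℕ → ℕ) → ∑< n f * c ≡ ∑< n (λ i → f i * c)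
*-distribʳ-∑< n c f = *-distribʳ-sum {n} c (λ i → f (toℕ i))

∑<-truncate : ∀ {p n} (g : ℕ → ℕ) → p < n →
  ∑< n (λ y → if p <ᵇ y then 0 else g y) ≡ ∑< (suc p) g
∑<-truncate {p} {suc n} g p<1+n with m<1+n⇒m<n∨m≡n p<1+n
... | inj₁ p<n = begin
  ∑< (suc n) F          ≡⟨ ∑<-suc n F ⟩
  ∑< n F + F n          ≡⟨ cong₂ _+_ (∑<-truncate g p<n) dropped ⟩
  ∑< (suc p) g + 0      ≡⟨ +-identityʳ _ ⟩
  ∑< (suc p) g          ∎
  where
  F = λ y → if p <ᵇ y then 0 else g y
  dropped : F n ≡ 0
  dropped = cong (λ b → if b then 0 else g n) (dec-true (p <? n) p<n)
... | inj₂ refl = begin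
  ∑< (suc p) F          ≡⟨ ∑<-suc p F ⟩
  ∑< p F + F p          ≡⟨ cong₂ _+_ (∑<-cong p (λ y → kept y ∘ <⇒≯)) (kept p (n≮n p)) ⟩
  ∑< p g + g p          ≡⟨ ∑<-suc p g ⟨
  ∑< (suc p) g          ∎
  where
  F = λ y → if p <ᵇ y then 0 else g y
  kept : ∀ y → ¬ p < y → F y ≡ g y
  kept y p≮y = cong (λ b → if b then 0 else g y) (dec-false (p <? y) p≮y)

hockey-stick : ∀ L p → ∑< (suc p) (λ y → (L + y) C y) ≡ (suc L + p) C p
hockey-stick L zero    = refl
hockey-stick L (suc p) = begin
  ∑< (suc (suc p)) F                       ≡⟨ ∑<-suc (suc p) F ⟩
  ∑< (suc p) F + F (suc p)                 ≡⟨ cong (_+ F (suc p)) (hockey-stick L p) ⟩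
  (suc L + p) C p + (L + suc p) C suc p    ≡⟨ cong (λ n → n C p + (L + suc p) C suc p) (+-suc L p) ⟨
  (L + suc p) C p + (L + suc p) C suc p    ≡⟨ nCk+nC[k+1]≡[n+1]C[k+1] (L + suc p) p ⟩
  (suc L + suc p) C suc p                  ∎
  where F = λ y → (L + y) C y

module _ {A B : Set} where

  sum-map-concatMap : (h : B → ℕ) (g : A → List B) (xs : List A) →
    sum (map h (concatMap g xs)) ≡ sum (map (λ x → sum (map h (g x))) xs)
  sum-map-concatMap h g []       = refl
  sum-map-concatMap h g (x ∷ xs) = begin
    sum (map h (g x ++ concatMap g xs))               ≡⟨ cong sum (map-++ h (g x) _) ⟩
    sum (map h (g x) ++ map h (concatMap g xs))       ≡⟨ sum-++ (map h (g x)) _ ⟩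
    sum (map h (g x)) + sum (map h (concatMap g xs))  ≡⟨ cong (_ +_) (sum-map-concatMap h g xs) ⟩
    sum (map (λ x → sum (map h (g x))) (x ∷ xs))      ∎

  length-filterᵇ-concatMap : (P : B → Bool) (g : A → List B) (xs : List A) →
    length (filterᵇ P (concatMap g xs)) ≡ sum (map (λ x → length (filterᵇ P (g x))) xs)
  length-filterᵇ-concatMap P g []       = refl
  length-filterᵇ-concatMap P g (x ∷ xs) = begin
    length (filterᵇ P (g x ++ concatMap g xs))
      ≡⟨ cong length (filter-++ (T? ∘ P) (g x) _) ⟩
    length (filterᵇ P (g x) ++ filterᵇ P (concatMap g xs))
      ≡⟨ length-++ (filterᵇ P (g x)) ⟩
    length (filterᵇ P (g x)) + length (filterᵇ P (concatMap g xs))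
      ≡⟨ cong (_ +_) (length-filterᵇ-concatMap P g xs) ⟩
    sum (map (λ x → length (filterᵇ P (g x))) (x ∷ xs)) ∎

  length-filterᵇ-map : (P : B → Bool) (f : A → B) (xs : List A) →
    length (filterᵇ P (map f xs)) ≡ length (filterᵇ (P ∘ f) xs)
  length-filterᵇ-map P f []       = refl
  length-filterᵇ-map P f (x ∷ xs) with P (f x)
  ... | true  = cong suc (length-filterᵇ-map P f xs)
  ... | false = length-filterᵇ-map P f xs

filterᵇ-cong : ∀ {A : Set} {P Q : A → Bool} → (∀ x → P x ≡ Q x) →
  ∀ xs → filterᵇ P xs ≡ filterᵇ Q xs
filterᵇ-cong             e []       = refl
filterᵇ-cong {P = P} {Q} e (x ∷ xs) with P x | Q x | e x
... | true  | .true  | refl = cong (x ∷_) (filterᵇ-cong e xs)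
... | false | .false | refl = filterᵇ-cong e xs

length-filterᵇ-none : ∀ {A : Set} {P : A → Bool} → (∀ x → P x ≡ false) →
  ∀ xs → length (filterᵇ P xs) ≡ 0
length-filterᵇ-none         e []       = refl
length-filterᵇ-none {P = P} e (x ∷ xs) with P x | e x
... | .false | refl = length-filterᵇ-none e xs

sum-map-*ˡ : ∀ {A : Set} c (h : A → ℕ) (xs : List A) →
  sum (map (λ x → c * h x) xs) ≡ c * sum (map h xs)
sum-map-*ˡ c h []       = sym (*-zeroʳ c)
sum-map-*ˡ c h (x ∷ xs) = trans (cong (c * h x +_) (sum-map-*ˡ c h xs)) (sym (*-distribˡ-+ c (h x) _))

sum-map-applyUpTo : ∀ (h : ℕ → ℕ) g n → sum (map h (applyUpTo g n)) ≡ ∑< n (h ∘ g)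
sum-map-applyUpTo h g zero    = refl
sum-map-applyUpTo h g (suc n) = cong (h (g 0) +_) (sum-map-applyUpTo h (g ∘ suc) n)

sum-map-tabulate : ∀ {A : Set} {n} (h : A → ℕ) (g : Fin n → A) →
  sum (map h (tabulate g)) ≡ ∑[ i < n ] h (g i)
sum-map-tabulate {n = zero}  h g = refl
sum-map-tabulate {n = suc n} h g = cong (h (g zero) +_) (sum-map-tabulate h (g ∘ suc))

cStep-suc : ∀ f n k → cStep f n (suc k) ≡ ∑< n (λ i → f (suc i) * cStep f (n ∸ suc i) k)
cStep-suc f zero    k = refl
cStep-suc f n@(suc _) k = begin
  sum (map π (concatMap parts (upTo n)))                ≡⟨ sum-map-concatMap π parts (upTo n) ⟩
  sum (map (λ i → sum (map π (parts i))) (upTo n))      ≡⟨ sum-map-applyUpTo _ (λ i → i) n ⟩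
  ∑< n (λ i → sum (map π (parts i)))                    ≡⟨ ∑<-cong n (λ i _ → first-part i) ⟩
  ∑< n (λ i → f (suc i) * cStep f (n ∸ suc i) k)        ∎
  where
  π = λ t → product (map f t)
  parts = λ i → map (suc i ∷_) (compositions (n ∸ suc i) k)
  first-part : ∀ i → sum (map π (parts i)) ≡ f (suc i) * cStep f (n ∸ suc i) k
  first-part i = trans (cong sum (sym (map-∘ (compositions (n ∸ suc i) k))))
                       (sum-map-*ˡ (f (suc i)) π (compositions (n ∸ suc i) k))

cStep-cong : ∀ {f g} → (∀ i → f (suc i) ≡ g (suc i)) → ∀ n k → cStep f n k ≡ cStep g n k
cStep-cong e zero    zero    = refl
cStep-cong e (suc n) zero    = refl
cStep-cong {f} {g} e n (suc k) = begin
  cStep f n (suc k)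
    ≡⟨ cStep-suc f n k ⟩
  ∑< n (λ i → f (suc i) * cStep f (n ∸ suc i) k)
    ≡⟨ ∑<-cong n (λ i _ → cong₂ _*_ (e i) (cStep-cong e (n ∸ suc i) k)) ⟩
  ∑< n (λ i → g (suc i) * cStep g (n ∸ suc i) k)
    ≡⟨ cStep-suc g n k ⟨
  cStep g n (suc k) ∎

iverson : Bool → ℕ
iverson b = if b then 1 else 0

shiftIf : Bool → (ℕ → ℕ) → ℕ → ℕ
shiftIf false f j       = f j
shiftIf true  f zero    = 0
shiftIf true  f (suc j) = f j

shiftIf-cong : ∀ b {f g : ℕ → ℕ} → (∀ j → f j ≡ g j) →
  ∀ j → shiftIf b f j ≡ shiftIf b g j
shiftIf-cong false e j       = e j
shiftIf-cong true  e zero    = refl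
shiftIf-cong true  e (suc j) = e j

shiftIf-below : ∀ {y t} (f : ℕ → ℕ) j → y < t → shiftIf (y ≡ᵇ t) f j ≡ f j
shiftIf-below {y} {t} f j y<t = cong (λ b → shiftIf b f j) (dec-false (y ≟ t) (<⇒≢ y<t))

length-filterᵇ-guarded : ∀ {A : Set} (b c : Bool) (Q : A → Bool) (o : A → ℕ) j (ws : List A) →
  length (filterᵇ (λ w → (b ∧ Q w) ∧ (iverson c + o w ≡ᵇ j)) ws)
    ≡ iverson b * shiftIf c (λ j → length (filterᵇ (λ w → Q w ∧ (o w ≡ᵇ j)) ws)) j
length-filterᵇ-guarded false c     Q o j       ws = length-filterᵇ-none (λ _ → refl) ws
length-filterᵇ-guarded true  false Q o j       ws = sym (+-identityʳ _)
length-filterᵇ-guarded true  true  Q o zero    ws = length-filterᵇ-none (∧-zeroʳ ∘ Q) ws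
length-filterᵇ-guarded true  true  Q o (suc j) ws = sym (+-identityʳ _)

module _ (a : ℕ) where

  noRise : ℕ → ℕ → Bool
  noRise x y = not ((x <ᵇ a) ∧ (y <ᵇ a) ∧ (x <ᵇ y))

  P₂-after : ∀ {q} → ℕ → List (Fin q) → Bool
  P₂-after p []      = true
  P₂-after p (y ∷ w) = noRise p (toℕ y) ∧ P₂-after (toℕ y) w

  -- Transfer recursion on the value p of the preceding letter, counting letters of value t.
  -- A value p ≥ a constrains nothing, and t = q tracks no letter.
  #P₂ : (q t L p j : ℕ) → ℕ
  #P₂ q t zero    p zero    = 1
  #P₂ q t zero    p (suc j) = 0
  #P₂ q t (suc L) p j       = ∑< q (λ y → iverson (noRise p y) * shiftIf (y ≡ᵇ t) (#P₂ q t L y) j)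

  #P₂-counts : ∀ q t L p j →
    length (filterᵇ (λ w → P₂-after p w ∧ (occ t w ≡ᵇ j)) (words q L)) ≡ #P₂ q t L p j
  #P₂-counts q t zero    p zero    = refl
  #P₂-counts q t zero    p (suc j) = refl
  #P₂-counts q t (suc L) p j       = begin
    length (filterᵇ P (concatMap (λ x → map (x ∷_) (words q L)) (allFin q)))
      ≡⟨ length-filterᵇ-concatMap P _ (allFin q) ⟩
    sum (map (λ x → length (filterᵇ P (map (x ∷_) (words q L)))) (allFin q))
      ≡⟨ sum-map-tabulate {n = q} _ (λ x → x) ⟩
    ∑[ x < q ] length (filterᵇ P (map (x ∷_) (words q L)))
      ≡⟨ sum-cong-≗ {q} first-letter ⟩
    #P₂ q t (suc L) p j ∎
    where
    P = λ w → P₂-after p w ∧ (occ t w ≡ᵇ j)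
    count-after = λ y j → length (filterᵇ (λ w → P₂-after y w ∧ (occ t w ≡ᵇ j)) (words q L))
    first-letter : ∀ x → length (filterᵇ P (map (x ∷_) (words q L)))
      ≡ iverson (noRise p (toℕ x)) * shiftIf (toℕ x ≡ᵇ t) (#P₂ q t L (toℕ x)) j
    first-letter x = begin
      length (filterᵇ P (map (x ∷_) (words q L)))
        ≡⟨ length-filterᵇ-map P (x ∷_) (words q L) ⟩
      length (filterᵇ (P ∘ (x ∷_)) (words q L))
        ≡⟨ length-filterᵇ-guarded (noRise p y) (y ≡ᵇ t) (P₂-after y) (occ t) j (words q L) ⟩
      iverson (noRise p y) * shiftIf (y ≡ᵇ t) (count-after y) j
        ≡⟨ cong (iverson (noRise p y) *_) (shiftIf-cong (y ≡ᵇ t) (#P₂-counts q t L y) j) ⟩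
      iverson (noRise p y) * shiftIf (y ≡ᵇ t) (#P₂ q t L y) j ∎
      where y = toℕ x

  P₂-cons : ∀ {q} (x : Fin q) w → P₂ a (x ∷ w) ≡ P₂-after (toℕ x) w
  P₂-cons x []      = refl
  P₂-cons x (y ∷ w) = cong (noRise (toℕ x) (toℕ y) ∧_) (P₂-cons y w)

  P₂≡P₂-after : ∀ {q} (w : List (Fin q)) → P₂ a w ≡ P₂-after a w
  P₂≡P₂-after []      = refl
  P₂≡P₂-after (x ∷ w) rewrite dec-false (a <? a) (n≮n a) = P₂-cons x w

  wordCount≡#P₂ : ∀ m n k → wordCount a m n k ≡ #P₂ (a + m) (a + m ∸ 1) (n ∸ 1) a (k ∸ 1)
  wordCount≡#P₂ m n k = trans (cong length (filterᵇ-cong same-test (words (a + m) (n ∸ 1))))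
                              (#P₂-counts (a + m) (a + m ∸ 1) (n ∸ 1) a (k ∸ 1))
    where
    same-test : ∀ w → (P₂ a w ∧ (occ (a + m ∸ 1) w ≡ᵇ (k ∸ 1)))
                    ≡ (P₂-after a w ∧ (occ (a + m ∸ 1) w ≡ᵇ (k ∸ 1)))
    same-test w = cong (_∧ (occ (a + m ∸ 1) w ≡ᵇ (k ∸ 1))) (P₂≡P₂-after w)

  noRise-from-large : ∀ {p} y → a ≤ p → noRise p y ≡ true
  noRise-from-large {p} y a≤p rewrite dec-false (p <? a) (≤⇒≯ a≤p) = refl

  noRise-to-large : ∀ p {y} → a ≤ y → noRise p y ≡ true
  noRise-to-large p {y} a≤y with p <ᵇ a
  ... | false = refl
  ... | true rewrite dec-false (y <? a) (≤⇒≯ a≤y) = refl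

  noRise-nonincreasing : ∀ {p y} → p < a → y ≤ p → noRise p y ≡ true
  noRise-nonincreasing {p} {y} p<a y≤p
    rewrite dec-true (p <? a) p<a | dec-false (p <? y) (≤⇒≯ y≤p) | ∧-zeroʳ (y <ᵇ a) = refl

  iverson-noRise-small : ∀ {p y} → p < a → y < a →
    ∀ z → iverson (noRise p y) * z ≡ (if p <ᵇ y then 0 else z)
  iverson-noRise-small {p} {y} p<a y<a z
    rewrite dec-true (p <? a) p<a | dec-true (y <? a) y<a with p <ᵇ y
  ... | true  = refl
  ... | false = +-identityʳ z

  #P₂-prev-cong : ∀ {q t p p'} → (∀ y → y < q → noRise p y ≡ noRise p' y) →
    ∀ L j → #P₂ q t L p j ≡ #P₂ q t L p' j
  #P₂-prev-cong e zero    zero    = refl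
  #P₂-prev-cong e zero    (suc j) = refl
  #P₂-prev-cong {q} {t} e (suc L) j =
    ∑<-cong q (λ y y<q → cong (λ b → iverson b * shiftIf (y ≡ᵇ t) (#P₂ q t L y) j) (e y y<q))

  #P₂-vanish : ∀ {q t} L p j → L < j → #P₂ q t L p j ≡ 0
  #P₂-vanish zero p (suc j) _ = refl
  #P₂-vanish {q} {t} (suc L) p j L<j = ∑<-zero q (λ y _ → begin
    ι y * shiftIf (y ≡ᵇ t) (#P₂ q t L y) j  ≡⟨ cong (ι y *_) (shifted y (y ≡ᵇ t) j L<j) ⟩
    ι y * 0                                 ≡⟨ *-zeroʳ (ι y) ⟩
    0                                       ∎)
    where
    ι = λ y → iverson (noRise p y)
    shifted : ∀ y b j → suc L < j → shiftIf b (#P₂ q t L y) j ≡ 0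
    shifted y false j       L<j       = #P₂-vanish L y j (<-trans (n<1+n L) L<j)
    shifted y true  (suc j) (s≤s L<j) = #P₂-vanish L y j L<j

  #P₂-sum-occurrences : ∀ q t L p → ∑< (suc L) (#P₂ q t L p) ≡ #P₂ q q L p 0
  #P₂-sum-occurrences q t zero    p = refl
  #P₂-sum-occurrences q t (suc L) p = begin
    ∑< (suc (suc L)) (λ j → ∑< q (λ y → ι y * shiftIf (y ≡ᵇ t) (Z y) j))
      ≡⟨ ∑<-comm (suc (suc L)) q (λ j y → ι y * shiftIf (y ≡ᵇ t) (Z y) j) ⟩
    ∑< q (λ y → ∑< (suc (suc L)) (λ j → ι y * shiftIf (y ≡ᵇ t) (Z y) j))
      ≡⟨ ∑<-cong q (λ y y<q → begin
           ∑< (suc (suc L)) (λ j → ι y * shiftIf (y ≡ᵇ t) (Z y) j)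
             ≡⟨ *-distribˡ-∑< (suc (suc L)) (ι y) (shiftIf (y ≡ᵇ t) (Z y)) ⟨
           ι y * ∑< (suc (suc L)) (shiftIf (y ≡ᵇ t) (Z y))
             ≡⟨ cong (ι y *_) (shifted-total y (y ≡ᵇ t)) ⟩
           ι y * ∑< (suc L) (Z y)
             ≡⟨ cong (ι y *_) (#P₂-sum-occurrences q t L y) ⟩
           ι y * #P₂ q q L y 0
             ≡⟨ cong (ι y *_) (shiftIf-below (#P₂ q q L y) 0 y<q) ⟨
           ι y * shiftIf (y ≡ᵇ q) (#P₂ q q L y) 0 ∎) ⟩
    #P₂ q q (suc L) p 0 ∎
    where
    ι = λ y → iverson (noRise p y)
    Z = #P₂ q t L
    shifted-total : ∀ y b → ∑< (suc (suc L)) (shiftIf b (Z y)) ≡ ∑< (suc L) (Z y)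
    shifted-total y true  = refl
    shifted-total y false = begin
      ∑< (suc (suc L)) (Z y)          ≡⟨ ∑<-suc (suc L) (Z y) ⟩
      ∑< (suc L) (Z y) + Z y (suc L)  ≡⟨ cong (∑< (suc L) (Z y) +_) (#P₂-vanish L y _ ≤-refl) ⟩
      ∑< (suc L) (Z y) + 0            ≡⟨ +-identityʳ _ ⟩
      ∑< (suc L) (Z y)                ∎

  #P₂-without-top : ∀ b L p → #P₂ (suc b) b L p 0 ≡ #P₂ b b L p 0
  #P₂-without-top b zero    p = refl
  #P₂-without-top b (suc L) p = begin
    ∑< (suc b) F              ≡⟨ ∑<-suc b F ⟩
    ∑< b F + F b              ≡⟨ cong₂ _+_ (∑<-cong b below-top) top-excluded ⟩
    #P₂ b b (suc L) p 0 + 0   ≡⟨ +-identityʳ _ ⟩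
    #P₂ b b (suc L) p 0       ∎
    where
    ι = λ y → iverson (noRise p y)
    F = λ y → ι y * shiftIf (y ≡ᵇ b) (#P₂ (suc b) b L y) 0
    top-excluded : F b ≡ 0
    top-excluded rewrite dec-true (b ≟ b) refl = *-zeroʳ (ι b)
    below-top : ∀ y → y < b → F y ≡ ι y * shiftIf (y ≡ᵇ b) (#P₂ b b L y) 0
    below-top y y<b = begin
      F y                                       ≡⟨ cong (ι y *_) (shiftIf-below _ 0 y<b) ⟩
      ι y * #P₂ (suc b) b L y 0                 ≡⟨ cong (ι y *_) (#P₂-without-top b L y) ⟩
      ι y * #P₂ b b L y 0                       ≡⟨ cong (ι y *_) (shiftIf-below _ 0 y<b) ⟨
      ι y * shiftIf (y ≡ᵇ b) (#P₂ b b L y) 0    ∎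

  -- Cut at the first top letter b: since b ≥ a, it decouples the top-free prefix from the rest.
  #P₂-split-at-first-top : ∀ b → a ≤ b → ∀ L p j →
    #P₂ (suc b) b L p (suc j) ≡ ∑< L (λ i → #P₂ b b i p 0 * #P₂ (suc b) b (L ∸ suc i) a j)
  #P₂-split-at-first-top b a≤b zero    p j = refl
  #P₂-split-at-first-top b a≤b (suc L) p j = begin
    ∑< (suc b) F                  ≡⟨ ∑<-suc b F ⟩
    ∑< b F + F b                  ≡⟨ cong₂ _+_ top-later top-first ⟩
    later + Z L a j               ≡⟨ +-comm later (Z L a j) ⟩
    Z L a j + later               ≡⟨ cong (_+ later) (*-identityˡ (Z L a j)) ⟨
    H p 0 * Z L a j + later       ∎
    where
    ι = λ y → iverson (noRise p y)
    Z = #P₂ (suc b) b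
    H = λ y i → #P₂ b b i y 0
    R = λ i → Z (L ∸ suc i) a j
    F = λ y → ι y * shiftIf (y ≡ᵇ b) (Z L y) (suc j)
    later = ∑< L (λ i → H p (suc i) * R i)

    top-first : F b ≡ Z L a j
    top-first = begin
      F b              ≡⟨ cong (λ c → ι b * shiftIf c (Z L b) (suc j)) (dec-true (b ≟ b) refl) ⟩
      ι b * Z L b j    ≡⟨ cong (λ c → iverson c * Z L b j) (noRise-to-large p a≤b) ⟩
      1 * Z L b j      ≡⟨ *-identityˡ _ ⟩
      Z L b j          ≡⟨ #P₂-prev-cong {suc b} {b} {b} {a} both-unconstrained L j ⟩
      Z L a j          ∎
      where
      both-unconstrained : ∀ y → y < suc b → noRise b y ≡ noRise a y
      both-unconstrained y _ = trans (noRise-from-large y a≤b) (sym (noRise-from-large y ≤-refl))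

    top-later : ∑< b F ≡ later
    top-later = begin
      ∑< b F
        ≡⟨ ∑<-cong b (λ y y<b → begin
             F y
               ≡⟨ cong (ι y *_) (shiftIf-below (Z L y) (suc j) y<b) ⟩
             ι y * Z L y (suc j)
               ≡⟨ cong (ι y *_) (#P₂-split-at-first-top b a≤b L y j) ⟩
             ι y * ∑< L (λ i → H y i * R i)
               ≡⟨ *-distribˡ-∑< L (ι y) (λ i → H y i * R i) ⟩
             ∑< L (λ i → ι y * (H y i * R i)) ∎) ⟩
      ∑< b (λ y → ∑< L (λ i → ι y * (H y i * R i)))
        ≡⟨ ∑<-comm b L (λ y i → ι y * (H y i * R i)) ⟩
      ∑< L (λ i → ∑< b (λ y → ι y * (H y i * R i)))
        ≡⟨ ∑<-cong L (λ i _ → first-letter i) ⟩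
      later ∎
      where
      first-letter : ∀ i → ∑< b (λ y → ι y * (H y i * R i)) ≡ H p (suc i) * R i
      first-letter i = begin
        ∑< b (λ y → ι y * (H y i * R i))
          ≡⟨ ∑<-cong b (λ y y<b → begin
               ι y * (H y i * R i)
                 ≡⟨ *-assoc (ι y) _ _ ⟨
               ι y * H y i * R i
                 ≡⟨ cong (λ z → ι y * z * R i) (shiftIf-below _ 0 y<b) ⟨
               ι y * shiftIf (y ≡ᵇ b) (#P₂ b b i y) 0 * R i ∎) ⟩
        ∑< b (λ y → ι y * shiftIf (y ≡ᵇ b) (#P₂ b b i y) 0 * R i)
          ≡⟨ *-distribʳ-∑< b (R i) (λ y → ι y * shiftIf (y ≡ᵇ b) (#P₂ b b i y) 0) ⟨
        H p (suc i) * R i ∎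

  #P₂-nonincreasing : ∀ L {p} → p < a → #P₂ a a L p 0 ≡ (L + p) C p
  #P₂-nonincreasing zero    {p} _   = sym (nCn≡1 p)
  #P₂-nonincreasing (suc L) {p} p<a = begin
    ∑< a (λ y → ι y * shiftIf (y ≡ᵇ a) (#P₂ a a L y) 0)
      ≡⟨ ∑<-cong a (λ y y<a → begin
           ι y * shiftIf (y ≡ᵇ a) (#P₂ a a L y) 0  ≡⟨ cong (ι y *_) (shiftIf-below _ 0 y<a) ⟩
           ι y * #P₂ a a L y 0                     ≡⟨ iverson-noRise-small p<a y<a _ ⟩
           (if p <ᵇ y then 0 else #P₂ a a L y 0)
             ≡⟨ cong (if p <ᵇ y then 0 else_) (#P₂-nonincreasing L y<a) ⟩
           (if p <ᵇ y then 0 else (L + y) C y)     ∎) ⟩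
    ∑< a (λ y → if p <ᵇ y then 0 else (L + y) C y)  ≡⟨ ∑<-truncate (λ y → (L + y) C y) p<a ⟩
    ∑< (suc p) (λ y → (L + y) C y)                   ≡⟨ hockey-stick L p ⟩
    (suc L + p) C p                                  ∎
    where ι = λ y → iverson (noRise p y)

  P₂Words : ℕ → ℕ → ℕ
  P₂Words b n = #P₂ b b (n ∸ 1) a 0

  cStep-P₂Words : ∀ b → a ≤ b → ∀ L j →
    cStep (P₂Words b) (suc L) (suc j) ≡ #P₂ (suc b) b L a j
  cStep-P₂Words b a≤b L zero = begin
    cStep G (suc L) 1      ≡⟨ cStep-suc G (suc L) 0 ⟩
    ∑< (suc L) F           ≡⟨ ∑<-suc L F ⟩
    ∑< L F + F L           ≡⟨ cong₂ _+_ (∑<-zero L nonempty-rest) empty-rest ⟩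
    0 + G (suc L) * 1      ≡⟨ *-identityʳ _ ⟩
    #P₂ b b L a 0          ≡⟨ #P₂-without-top b L a ⟨
    #P₂ (suc b) b L a 0    ∎
    where
    G = P₂Words b
    F = λ i → G (suc i) * cStep G (L ∸ i) 0
    nonempty-rest : ∀ i → i < L → F i ≡ 0
    nonempty-rest i i<L =
      trans (cong (λ n → G (suc i) * cStep G n 0) (+-∸-assoc 1 i<L)) (*-zeroʳ (G (suc i)))
    empty-rest : F L ≡ G (suc L) * 1
    empty-rest = cong (λ n → G (suc L) * cStep G n 0) (n∸n≡0 L)
  cStep-P₂Words b a≤b L (suc j) = begin
    cStep G (suc L) (suc (suc j))  ≡⟨ cStep-suc G (suc L) (suc j) ⟩
    ∑< (suc L) F                   ≡⟨ ∑<-suc L F ⟩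
    ∑< L F + F L                   ≡⟨ cong₂ _+_ (∑<-cong L (λ i → cong (G (suc i) *_) ∘ rest i)) no-last ⟩
    ∑< L (λ i → G (suc i) * #P₂ (suc b) b (L ∸ suc i) a j) + 0
                                   ≡⟨ +-identityʳ _ ⟩
    ∑< L (λ i → G (suc i) * #P₂ (suc b) b (L ∸ suc i) a j)
                                   ≡⟨ #P₂-split-at-first-top b a≤b L a j ⟨
    #P₂ (suc b) b L a (suc j)      ∎
    where
    G = P₂Words b
    F = λ i → G (suc i) * cStep G (L ∸ i) (suc j)
    rest : ∀ i → i < L → cStep G (L ∸ i) (suc j) ≡ #P₂ (suc b) b (L ∸ suc i) a j
    rest i i<L = trans (cong (λ n → cStep G n (suc j)) (+-∸-assoc 1 i<L))
                       (cStep-P₂Words b a≤b (L ∸ suc i) j)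
    no-last : F L ≡ 0
    no-last = trans (cong (λ n → G (suc L) * cStep G n (suc j)) (n∸n≡0 L)) (*-zeroʳ (G (suc L)))

f0≡P₂Words : ∀ a' i → f0 (suc a') (suc i) ≡ P₂Words (suc a') (suc a') (suc i)
f0≡P₂Words a' i = begin
  (i + suc a' ∸ 1) C a'   ≡⟨ cong (λ n → (n ∸ 1) C a') (+-suc i a') ⟩
  (i + a') C a'           ≡⟨ #P₂-nonincreasing a i (n<1+n a') ⟨
  #P₂ a a a i a' 0        ≡⟨ #P₂-prev-cong a same-constraint i 0 ⟩
  #P₂ a a a i a 0         ∎
  where
  a = suc a'
  same-constraint : ∀ y → y < a → noRise a a' y ≡ noRise a a y
  same-constraint y y<a = trans (noRise-nonincreasing a (n<1+n a') (m<1+n⇒m≤n y<a))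
                                (sym (noRise-from-large a y ≤-refl))

fIter-f0≡P₂Words : ∀ a' m i → fIter (f0 (suc a')) m (suc i) ≡ P₂Words (suc a') (suc a' + m) (suc i)
fIter-f0≡P₂Words a' zero    i =
  trans (f0≡P₂Words a' i) (cong (λ b → P₂Words (suc a') b (suc i)) (sym (+-identityʳ (suc a'))))
fIter-f0≡P₂Words a' (suc m) i = begin
  fStep F (suc i)
    ≡⟨ sum-map-applyUpTo _ (λ k → k) (suc i) ⟩
  ∑< (suc i) (λ k → cStep F (suc i) (suc k))
    ≡⟨ ∑<-cong (suc i) (λ k _ → cStep-cong {F} {P₂Words a b} (fIter-f0≡P₂Words a' m) (suc i) (suc k)) ⟩
  ∑< (suc i) (λ k → cStep (P₂Words a b) (suc i) (suc k))
    ≡⟨ ∑<-cong (suc i) (λ k _ → cStep-P₂Words a b (m≤m+n a m) i k) ⟩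
  ∑< (suc i) (#P₂ a (suc b) b i a)
    ≡⟨ #P₂-sum-occurrences a (suc b) b i a ⟩
  #P₂ a (suc b) (suc b) i a 0
    ≡⟨ cong (λ c → #P₂ a c c i a 0) (+-suc a m) ⟨
  P₂Words a (a + suc m) (suc i) ∎
  where
  a = suc a'
  b = a + m
  F = fIter (f0 a) m

mainTheorem6 : (a m : ℕ) → 1 ≤ a → 1 ≤ m →
    (n k : ℕ) → 1 ≤ k → k ≤ n →
    cm (f0 a) m n k ≡ wordCount a m n k
mainTheorem6 (suc a') (suc m) _ _ zero    (suc k) _ ()
mainTheorem6 (suc a') (suc m) _ _ (suc L) (suc k) _ _ = begin
  cStep (fIter (f0 a) m) (suc L) (suc k)
    ≡⟨ cStep-cong {fIter (f0 a) m} {P₂Words a (a + m)} (fIter-f0≡P₂Words a' m) (suc L) (suc k) ⟩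
  cStep (P₂Words a (a + m)) (suc L) (suc k)
    ≡⟨ cStep-P₂Words a (a + m) (m≤m+n a m) L k ⟩
  #P₂ a (suc (a + m)) (a + m) L a k
    ≡⟨ cong (λ q → #P₂ a q (q ∸ 1) L a k) (+-suc a m) ⟨
  #P₂ a (a + suc m) (a + suc m ∸ 1) L a k
    ≡⟨ wordCount≡#P₂ a (suc m) (suc L) (suc k) ⟨
  wordCount a (suc m) (suc L) (suc k) ∎
  where a = suc a'
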